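{- Let $G$ be a connected finite simple graph containing no theta, no wheel and no prism as an induced subgraph. If $G$ contains a hole of length 4, then either $G$ is a hole of length 4 or $G$ has a clique cutset.
   Context: A hole is a chordless cycle of length at least 4. A prism consists of three node-disjoint chordless paths $a_1\dots b_1$, $a_2\dots b_2$, $a_3\dots b_3$ of length at least 1 such that $a_1a_2a_3$ and $b_1b_2b_3$ are triangles and there are no other edges between the paths. A theta consists of three internally node-disjoint chordless paths between two nodes $a,b$, each of length at least 2, with no edges between the paths other than the three edges at $a$ and the three at $b$. A wheel is a hole $H$ plus a node $c\notin V(H)$ with at least three neighbors in $H$. A clique cutset is a set of nodes inducing a clique (possibly empty) whose removal disconnects the graph. -}

module Defs where

open import Data.Nat using (ℕ; zero; suc; _≤_; _<_)
open import Data.Fin using (Fin; toℕ; fromℕ)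
open import Data.Fin.Subset using (Subset; _∈_; _∉_)
open import Data.Product using (Σ; _×_; ∃; ∃-syntax)
open import Data.Sum using (_⊎_)
open import Relation.Binary.PropositionalEquality using (_≡_; _≢_)
open import Relation.Nullary using (¬_)
open import Relation.Binary using (Decidable)
open import Function.Definitions using (Injective)
open import Function.Bundles using (_⇔_)

record Graph (n : ℕ) : Set₁ where
  field
    Adj    : Fin n → Fin n → Set
    adj?   : Decidable Adj
    sym    : ∀ {u v} → Adj u v → Adj v u
    irrefl : ∀ {u} → ¬ Adj u u
open Graph public

module _ {n : ℕ} (G : Graph n) where

  IsChordlessPath : (k : ℕ) → (Fin (suc k) → Fin n) → Set
  IsChordlessPath k p =
    Injective _≡_ _≡_ p ×
    (∀ i j → Adj G (p i) (p j) ⇔ (suc (toℕ i) ≡ toℕ j ⊎ suc (toℕ j) ≡ toℕ i))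

  CycAdj : (k : ℕ) → Fin k → Fin k → Set
  CycAdj k i j =
    suc (toℕ i) ≡ toℕ j ⊎ suc (toℕ j) ≡ toℕ i ⊎
    (toℕ i ≡ 0 × suc (toℕ j) ≡ k) ⊎ (toℕ j ≡ 0 × suc (toℕ i) ≡ k)

  record Hole : Set where
    field
      len     : ℕ
      len≥4   : 4 ≤ len
      cyc     : Fin len → Fin n
      cyc-inj : Injective _≡_ _≡_ cyc
      cyc-ind : ∀ i j → Adj G (cyc i) (cyc j) ⇔ CycAdj len i j

  HoleOfLength : ℕ → Set
  HoleOfLength m = Σ Hole (λ H → Hole.len H ≡ m)

  Interior : (k : ℕ) → Fin (suc k) → Set
  Interior k i = 0 < toℕ i × toℕ i < k

  record Theta : Set where
    field
      a b    : Fin n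
      len    : Fin 3 → ℕ
      len≥2  : ∀ r → 2 ≤ len r
      path   : (r : Fin 3) → Fin (suc (len r)) → Fin n
      chordless : ∀ r → IsChordlessPath (len r) (path r)
      start  : ∀ r → path r Fin.zero ≡ a
      end    : ∀ r → path r (fromℕ (len r)) ≡ b
      disj   : ∀ r s → r ≢ s → ∀ i j → Interior (len r) i → Interior (len s) j →
               path r i ≢ path s j
      noEdge : ∀ r s → r ≢ s → ∀ i j → Interior (len r) i → Interior (len s) j →
               ¬ Adj G (path r i) (path s j)

  record Prism : Set where
    field
      len    : Fin 3 → ℕ
      len≥1  : ∀ r → 1 ≤ len r
      path   : (r : Fin 3) → Fin (suc (len r)) → Fin n
      chordless : ∀ r → IsChordlessPath (len r) (path r)
      disj   : ∀ r s → r ≢ s → ∀ i j → path r i ≢ path s j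
      edges  : ∀ r s → r ≢ s → ∀ i j →
               Adj G (path r i) (path s j) ⇔
               ((toℕ i ≡ 0 × toℕ j ≡ 0) ⊎ (toℕ i ≡ len r × toℕ j ≡ len s))

  record Wheel : Set where
    field
      rim    : Hole
      centre : Fin n
      notIn  : ∀ i → Hole.cyc rim i ≢ centre
      x y z  : Fin (Hole.len rim)
      x≢y    : x ≢ y
      x≢z    : x ≢ z
      y≢z    : y ≢ z
      adjx   : Adj G centre (Hole.cyc rim x)
      adjy   : Adj G centre (Hole.cyc rim y)
      adjz   : Adj G centre (Hole.cyc rim z)

  data ReachAvoiding (S : Subset n) : Fin n → Fin n → Set where
    here : ∀ {u} → u ∉ S → ReachAvoiding S u u
    step : ∀ {u v w} → u ∉ S → Adj G u v → ReachAvoiding S v w → ReachAvoiding S u w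

  Connected : Set
  Connected = ∀ u v → ReachAvoiding Data.Fin.Subset.⊥ u v

  IsClique : Subset n → Set
  IsClique S = ∀ u v → u ∈ S → v ∈ S → u ≢ v → Adj G u v

  HasCliqueCutset : Set
  HasCliqueCutset = ∃[ S ] (IsClique S × ∃[ u ] ∃[ v ] (u ∉ S × v ∉ S × ¬ ReachAvoiding S u v))

  IsHole4 : Set
  IsHole4 = Σ (HoleOfLength 4) (λ H → ∀ v → ∃[ i ] Hole.cyc (Σ.proj₁ H) i ≡ v)
    where import Data.Product as Σ

-- Write h₀h₁h₂h₃ for the 4-hole H. The key fact is that no walk avoiding H joins a neighbour
-- of h₀ to a neighbour of h₂ (nor, by symmetry, h₁ to h₃). A shortest such walk is a
-- chordless path P seeing h₀ only at its first and h₂ only at its last vertex. If neither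
-- h₁ nor h₃ has a neighbour on P we get a theta between h₀ and h₂; if exactly one, say h₁,
-- does, then h₁ is the centre of a wheel with rim h₀ P h₂ h₃. If both do, the segment of P
-- between their neighbours is a shorter such walk between h₁ and h₃, unless it is all of P;
-- then P, h₀h₃ and h₁h₂ form a prism (a wheel if P is a single vertex).
-- So if some vertex lies off H, a path from it to H yields a vertex x off H adjacent to a
-- corner, say h₀. The component of x in G − H is then not adjacent to h₂, nor to both h₁
-- and h₃, so the edge h₀h₁ or h₀h₃ separates x from h₂.

module Submission where

open import Defs renaming (sym to adj-sym)
open import Data.Nat using (ℕ; zero; suc; _+_; _∸_; _≤_; _<_; z≤n; s≤s; _≤?_; _≟_; s≤s⁻¹)
open import Relation.Binary.Definitions using (tri<; tri≈; tri>)
open import Data.Nat.Properties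
open import Data.Nat.Induction using (<-rec)
open import Data.Fin using (Fin; toℕ; fromℕ<)
import Data.Fin.Properties as Finₚ
import Data.Fin.Subset
open import Data.Fin.Subset using (Subset; _∈_; _∉_; ⁅_⁆; _∪_)
open import Data.Fin.Subset.Properties using (x∈⁅x⁆; x∈⁅y⁆⇒x≡y; x∈p∪q⁻; x∈p∪q⁺)
open import Data.Empty using (⊥; ⊥-elim)
open import Data.Product using (Σ; _×_; _,_; proj₁; proj₂; swap)
open import Data.Sum using (_⊎_; inj₁; inj₂)
import Data.Sum as Sum
open import Function using (_∘_; case_of_)
open import Function.Bundles using (_⇔_; mk⇔; Equivalence)
open import Function.Definitions using (Injective)
open Equivalence using (to; from)
open import Relation.Nullary using (¬_; Dec; yes; no)
open import Relation.Nullary.Decidable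
  using (decidable-stable; ¬?; _⊎-dec_; _×-dec_; _→-dec_; toWitness; toWitnessFalse)
open import Relation.Binary.PropositionalEquality using (_≡_; refl; sym; trans; cong; subst; subst₂; _≢_)

splice : {A : Set} → ℕ → (ℕ → A) → (ℕ → A) → ℕ → A
splice k f g t with t ≤? k
... | yes _ = f t
... | no  _ = g (t ∸ k)

module _ {A : Set} (k : ℕ) (f g : ℕ → A) where

  splice-≤ : ∀ {t} → t ≤ k → splice k f g t ≡ f t
  splice-≤ {t} t≤k with t ≤? k
  ... | yes _   = refl
  ... | no  t≰k = ⊥-elim (t≰k t≤k)

  splice-> : ∀ {t} → k < t → splice k f g t ≡ g (t ∸ k)
  splice-> {t} k<t with t ≤? k
  ... | yes t≤k = ⊥-elim (<⇒≱ k<t t≤k)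
  ... | no  _   = refl

  splice-≥ : f k ≡ g 0 → ∀ {t} → k ≤ t → splice k f g t ≡ g (t ∸ k)
  splice-≥ fk≡g0 {t} k≤t with t ≤? k
  ... | no  _   = refl
  ... | yes t≤k rewrite ≤-antisym t≤k k≤t | n∸n≡0 k = fk≡g0

module Walks {n : ℕ} (G : Graph n) (Allowed : Fin n → Set) where

  -- Only vertex 0, …, vertex k are part of the walk.
  record Walk (x y : Fin n) (k : ℕ) : Set where
    field
      vertex   : ℕ → Fin n
      start    : vertex 0 ≡ x
      end      : vertex k ≡ y
      adjacent : ∀ t → t < k → Adj G (vertex t) (vertex (suc t))
      allowed  : ∀ t → t ≤ k → Allowed (vertex t)
  open Walk public

  private variable
    x y z : Fin n
    k l : ℕ

  allowed-end : Walk x y k → Allowed y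
  allowed-end {k = k} W = subst Allowed (end W) (allowed W k ≤-refl)

  [_] : Allowed x → Walk x x 0
  [_] {x} ax = record
    { vertex = λ _ → x ; start = refl ; end = refl ; adjacent = λ _ () ; allowed = λ _ _ → ax }

  edge : Allowed x → Allowed y → Adj G x y → Walk x y 1
  edge {x} {y} ax ay x~y = record
    { vertex   = λ { zero → x ; (suc _) → y }
    ; start    = refl
    ; end      = refl
    ; adjacent = λ { zero _ → x~y ; (suc _) (s≤s ()) }
    ; allowed  = λ { zero _ → ax ; (suc _) _ → ay }
    }

  _++_ : Walk x y k → Walk y z l → Walk x z (k + l)
  _++_ {k = k} {l = l} V W = record
    { vertex   = u
    ; start    = trans (u-left z≤n) (start V)
    ; end      = trans (u-right (m≤m+n k l)) (trans (cong (vertex W) (m+n∸m≡n k l)) (end W))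
    ; adjacent = adj
    ; allowed  = all
    }
    where
    u = splice k (vertex V) (vertex W)
    junction : vertex V k ≡ vertex W 0
    junction = trans (end V) (sym (start W))
    u-left : ∀ {t} → t ≤ k → u t ≡ vertex V t
    u-left = splice-≤ k (vertex V) (vertex W)
    u-right : ∀ {t} → k ≤ t → u t ≡ vertex W (t ∸ k)
    u-right = splice-≥ k (vertex V) (vertex W) junction
    adj : ∀ t → t < k + l → Adj G (u t) (u (suc t))
    adj t t<k+l with k ≤? t
    ... | no  k≰t = subst₂ (Adj G) (sym (u-left (<⇒≤ t<k))) (sym (u-left t<k))
                      (adjacent V t t<k)
      where t<k = ≰⇒> k≰t
    ... | yes k≤t = subst₂ (Adj G) (sym (u-right k≤t))
                      (sym (trans (u-right (m≤n⇒m≤1+n k≤t)) (cong (vertex W) (+-∸-assoc 1 k≤t))))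
                      (adjacent W (t ∸ k) (subst (t ∸ k <_) (m+n∸m≡n k l) (∸-monoˡ-< t<k+l k≤t)))
    all : ∀ t → t ≤ k + l → Allowed (u t)
    all t t≤k+l with t ≤? k
    ... | yes t≤k = allowed V t t≤k
    ... | no  _   = allowed W (t ∸ k) (subst (t ∸ k ≤_) (m+n∸m≡n k l) (∸-monoˡ-≤ k t≤k+l))

  slice : (W : Walk x y k) (i j : ℕ) → i ≤ j → j ≤ k → Walk (vertex W i) (vertex W j) (j ∸ i)
  slice W i j i≤j j≤k = record
    { vertex   = λ t → vertex W (i + t)
    ; start    = cong (vertex W) (+-identityʳ i)
    ; end      = cong (vertex W) (m+[n∸m]≡n i≤j)
    ; adjacent = λ t t<j∸i → subst (λ s → Adj G (vertex W (i + t)) (vertex W s)) (sym (+-suc i t))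
                   (adjacent W (i + t) (≤-trans (shift (+-monoʳ-< i t<j∸i)) j≤k))
    ; allowed  = λ t t≤j∸i → allowed W (i + t) (≤-trans (shift (+-monoʳ-≤ i t≤j∸i)) j≤k)
    }
    where
    shift : ∀ {s} → s ≤ i + (j ∸ i) → s ≤ j
    shift = subst (_ ≤_) (m+[n∸m]≡n i≤j)

  reverse : Walk x y k → Walk y x k
  reverse {k = k} W = record
    { vertex   = λ t → vertex W (k ∸ t)
    ; start    = end W
    ; end      = trans (cong (vertex W) (n∸n≡0 k)) (start W)
    ; adjacent = adj
    ; allowed  = λ t _ → allowed W (k ∸ t) (m∸n≤m k t)
    }
    where
    adj : ∀ t → t < k → Adj G (vertex W (k ∸ t)) (vertex W (k ∸ suc t))
    adj t t<k = subst (λ s → Adj G (vertex W s) (vertex W (k ∸ suc t))) (sym k∸t≡1+k∸1+t)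
                  (adj-sym G (adjacent W (k ∸ suc t) (subst (_≤ k) k∸t≡1+k∸1+t (m∸n≤m k t))))
      where k∸t≡1+k∸1+t = +-∸-assoc 1 t<k

  init : (W : Walk x y (suc k)) → Walk x (vertex W k) k
  init W = record
    { vertex   = vertex W
    ; start    = start W
    ; end      = refl
    ; adjacent = λ t t<k → adjacent W t (m≤n⇒m≤1+n t<k)
    ; allowed  = λ t t≤k → allowed W t (m≤n⇒m≤1+n t≤k)
    }

  bypass : (W : Walk x y k) {i j m : ℕ} → i ≤ j → j ≤ k →
           Walk (vertex W i) (vertex W j) m → Walk x y (i + (m + (k ∸ j)))
  bypass W {i} {j} i≤j j≤k B = subst₂ (λ a b → Walk a b _) (start W) (end W)
    (slice W 0 i z≤n (≤-trans i≤j j≤k) ++ (B ++ slice W j _ j≤k ≤-refl))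

bypass-shorter : ∀ {i j k m} → m + i < j → j ≤ k → i + (m + (k ∸ j)) < k
bypass-shorter {i} {j} {k} {m} m+i<j j≤k = begin-strict
  i + (m + (k ∸ j))  ≡⟨ sym (+-assoc i m (k ∸ j)) ⟩
  i + m + (k ∸ j)    ≡⟨ cong (_+ (k ∸ j)) (+-comm i m) ⟩
  m + i + (k ∸ j)    <⟨ +-monoˡ-< (k ∸ j) m+i<j ⟩
  j + (k ∸ j)        ≡⟨ m+[n∸m]≡n j≤k ⟩
  k                  ∎
  where open ≤-Reasoning

proper-slice-shorter : ∀ {i j k} → i ≤ j → j ≤ k → i ≢ 0 ⊎ j ≢ k → j ∸ i < k
proper-slice-shorter {zero}          _         _   (inj₁ 0≢0) = ⊥-elim (0≢0 refl)
proper-slice-shorter {suc i} {suc j} (s≤s i≤j) j<k (inj₁ _)   = ≤-<-trans (m∸n≤m j i) j<k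
proper-slice-shorter {i} {j}         _         j≤k (inj₂ j≢k) = ≤-<-trans (m∸n≤m j i) (≤∧≢⇒< j≤k j≢k)

-- CycAdj G m i j unfolds to CycAdjℕ m (toℕ i) (toℕ j).
CycAdjℕ : ℕ → ℕ → ℕ → Set
CycAdjℕ m i j = suc i ≡ j ⊎ suc j ≡ i ⊎ (i ≡ 0 × suc j ≡ m) ⊎ (j ≡ 0 × suc i ≡ m)

CycAdjℕ-sym : ∀ {m i j} → CycAdjℕ m i j → CycAdjℕ m j i
CycAdjℕ-sym (inj₁ e)               = inj₂ (inj₁ e)
CycAdjℕ-sym (inj₂ (inj₁ e))        = inj₁ e
CycAdjℕ-sym (inj₂ (inj₂ (inj₁ e))) = inj₂ (inj₂ (inj₂ e))
CycAdjℕ-sym (inj₂ (inj₂ (inj₂ e))) = inj₂ (inj₂ (inj₁ e))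

CycAdjℕ? : ∀ m i j → Dec (CycAdjℕ m i j)
CycAdjℕ? m i j =
  (suc i ≟ j) ⊎-dec (suc j ≟ i) ⊎-dec ((i ≟ 0) ×-dec (suc j ≟ m)) ⊎-dec ((j ≟ 0) ×-dec (suc i ≟ m))

Consecutive : ℕ → ℕ → Set
Consecutive i j = suc i ≡ j ⊎ suc j ≡ i

holds⇔holds : {A B : Set} → A → B → A ⇔ B
holds⇔holds a b = mk⇔ (λ _ → b) (λ _ → a)

fails⇔fails : {A B : Set} → ¬ A → ¬ B → A ⇔ B
fails⇔fails ¬a ¬b = mk⇔ (⊥-elim ∘ ¬a) (⊥-elim ∘ ¬b)

_◂_ : {A : Set} → A → (ℕ → A) → ℕ → A
(x ◂ f) zero    = x
(x ◂ f) (suc t) = f t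

module Sequences {n : ℕ} (G : Graph n) where

  private variable
    a b c x y : Fin n
    i j k m : ℕ
    p q : ℕ → Fin n

  Separated : Fin n → Fin n → Set
  Separated x y = x ≢ y × ¬ Adj G x y

  adj⇒≢ : Adj G x y → x ≢ y
  adj⇒≢ x~y refl = irrefl G x~y

  adj-flip : {A B : Set} → (A → B) → (B → A) → Adj G x y ⇔ A → Adj G y x ⇔ B
  adj-flip f g x~y⇔A = mk⇔ (λ y~x → f (to x~y⇔A (adj-sym G y~x))) (λ b → adj-sym G (from x~y⇔A (g b)))

  record IsChordlessSeq (k : ℕ) (p : ℕ → Fin n) : Set where
    field
      injective : ∀ i j → i ≤ k → j ≤ k → p i ≡ p j → i ≡ j
      adjacent⇔ : ∀ i j → i ≤ k → j ≤ k → Adj G (p i) (p j) ⇔ Consecutive i j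

  record IsHoleSeq (m : ℕ) (p : ℕ → Fin n) : Set where
    field
      injective : ∀ i j → i < m → j < m → p i ≡ p j → i ≡ j
      adjacent⇔ : ∀ i j → i < m → j < m → Adj G (p i) (p j) ⇔ CycAdjℕ m i j

  toChordlessPath : IsChordlessSeq k p → IsChordlessPath G k (p ∘ toℕ)
  toChordlessPath P =
    (λ {i} {j} e → Finₚ.toℕ-injective (injective _ _ (Finₚ.toℕ≤pred[n] i) (Finₚ.toℕ≤pred[n] j) e)) ,
    (λ i j → adjacent⇔ _ _ (Finₚ.toℕ≤pred[n] i) (Finₚ.toℕ≤pred[n] j))
    where open IsChordlessSeq P

  toHole : 4 ≤ m → IsHoleSeq m p → Hole G
  toHole {m} {p} 4≤m H = record
    { len     = m
    ; len≥4   = 4≤m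
    ; cyc     = p ∘ toℕ
    ; cyc-inj = λ {i} {j} e → Finₚ.toℕ-injective (injective _ _ (Finₚ.toℕ<n i) (Finₚ.toℕ<n j) e)
    ; cyc-ind = λ i j → adjacent⇔ _ _ (Finₚ.toℕ<n i) (Finₚ.toℕ<n j)
    }
    where open IsHoleSeq H

  consecutive-flip : Adj G x y ⇔ Consecutive i j → Adj G y x ⇔ Consecutive j i
  consecutive-flip = adj-flip Sum.swap Sum.swap

  edge-seq : Adj G x y → IsChordlessSeq 1 (x ◂ λ _ → y)
  edge-seq {x} {y} x~y = record { injective = inj ; adjacent⇔ = adj⇔ }
    where
    inj : ∀ i j → i ≤ 1 → j ≤ 1 → (x ◂ λ _ → y) i ≡ (x ◂ λ _ → y) j → i ≡ j
    inj zero          zero          _ _ _ = refl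
    inj zero          (suc zero)    _ _ e = ⊥-elim (adj⇒≢ x~y e)
    inj (suc zero)    zero          _ _ e = ⊥-elim (adj⇒≢ x~y (sym e))
    inj (suc zero)    (suc zero)    _ _ _ = refl
    inj (suc (suc _)) _             (s≤s ()) _ _
    inj _             (suc (suc _)) _ (s≤s ()) _
    adj⇔ : ∀ i j → i ≤ 1 → j ≤ 1 → Adj G ((x ◂ λ _ → y) i) ((x ◂ λ _ → y) j) ⇔ Consecutive i j
    adj⇔ zero          zero          _ _ = fails⇔fails (irrefl G) λ { (inj₁ ()) ; (inj₂ ()) }
    adj⇔ zero          (suc zero)    _ _ = holds⇔holds x~y (inj₁ refl)
    adj⇔ (suc zero)    zero          _ _ = holds⇔holds (adj-sym G x~y) (inj₂ refl)
    adj⇔ (suc zero)    (suc zero)    _ _ = fails⇔fails (irrefl G) λ { (inj₁ ()) ; (inj₂ ()) }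
    adj⇔ (suc (suc _)) _             (s≤s ()) _
    adj⇔ _             (suc (suc _)) _ (s≤s ())

  single-seq : IsChordlessSeq 0 (λ _ → x)
  single-seq = record
    { injective = λ { zero zero _ _ _ → refl }
    ; adjacent⇔ = λ { zero zero _ _ → fails⇔fails (irrefl G) λ { (inj₁ ()) ; (inj₂ ()) } }
    }

  cap : ℕ → Fin n → (ℕ → Fin n) → Fin n → ℕ → Fin n
  cap k a p b = a ◂ splice k p (λ _ → b)

  cap-inner : ∀ {t} → t ≤ k → cap k a p b (suc t) ≡ p t
  cap-inner = splice-≤ _ _ _

  cap-right : cap k a p b (suc (suc k)) ≡ b
  cap-right {k} = splice-> k _ _ (n<1+n k)

  -- p is the interior of a chordless path a, p 0, …, p k, b.
  record ChordlessLink (a b : Fin n) (k : ℕ) (p : ℕ → Fin n) : Set where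
    field
      chordless : IsChordlessSeq k p
      ends-separated : Separated a b
      avoids-start : ∀ t → t ≤ k → p t ≢ a
      avoids-end   : ∀ t → t ≤ k → p t ≢ b
      touches-start : ∀ t → t ≤ k → Adj G (p t) a ⇔ t ≡ 0
      touches-end   : ∀ t → t ≤ k → Adj G (p t) b ⇔ t ≡ k

  data CapIndex (k : ℕ) : ℕ → Set where
    left  : CapIndex k 0
    inner : ∀ t → t ≤ k → CapIndex k (suc t)
    right : CapIndex k (suc (suc k))

  cap-index : ∀ i → i ≤ suc (suc k) → CapIndex k i
  cap-index zero _ = left
  cap-index {k} (suc t) t<2+k with t ≤? k
  ... | yes t≤k = inner t t≤k
  ... | no  t≰k rewrite ≤-antisym (s≤s⁻¹ t<2+k) (≰⇒> t≰k) = right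

  cap-all : ∀ {ℓ} (Q : Fin n → Set ℓ) → Q a → (∀ t → t ≤ k → Q (p t)) → Q b →
            ∀ i → i ≤ suc (suc k) → Q (cap k a p b i)
  cap-all {a} {k} {p} {b} Q qa qp qb i i≤2+k with cap-index i i≤2+k
  ... | left        = qa
  ... | inner t t≤k = subst Q (sym (cap-inner {a = a} {b = b} t≤k)) (qp t t≤k)
  ... | right       = subst Q (sym (cap-right {k = k} {a = a} {p = p})) qb

  cap-chordless : ChordlessLink a b k p → IsChordlessSeq (suc (suc k)) (cap k a p b)
  cap-chordless {a} {b} {k} {p} L = record
    { injective = λ i j i≤ j≤ → inj (cap-index i i≤) (cap-index j j≤)
    ; adjacent⇔ = λ i j i≤ j≤ → adj⇔ (cap-index i i≤) (cap-index j j≤)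
    }
    where
    open ChordlessLink L
    open IsChordlessSeq chordless
    w : ℕ → Fin n
    w = cap k a p b
    w-inner : ∀ {t} → t ≤ k → w (suc t) ≡ p t
    w-inner = cap-inner {a = a} {b = b}
    w-right : w (suc (suc k)) ≡ b
    w-right = cap-right {k = k} {a = a} {p = p}
    inj : ∀ {i j} → CapIndex k i → CapIndex k j → w i ≡ w j → i ≡ j
    inj left      left      _ = refl
    inj left      (inner t t≤k) e = ⊥-elim (avoids-start t t≤k (sym (trans e (w-inner t≤k))))
    inj left      right     e = ⊥-elim (proj₁ ends-separated (trans e w-right))
    inj (inner s s≤k) (inner t t≤k) e =
      cong suc (injective s t s≤k t≤k (trans (sym (w-inner s≤k)) (trans e (w-inner t≤k))))
    inj (inner s s≤k) right e = ⊥-elim (avoids-end s s≤k (trans (sym (w-inner s≤k)) (trans e w-right)))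
    inj right     right     _ = refl
    inj (inner s s≤k) left  e = sym (inj left (inner s s≤k) (sym e))
    inj right     left      e = sym (inj left right (sym e))
    inj right (inner t t≤k) e = sym (inj (inner t t≤k) right (sym e))
    adj⇔ : ∀ {i j} → CapIndex k i → CapIndex k j → Adj G (w i) (w j) ⇔ Consecutive i j
    adj⇔ left left = fails⇔fails (irrefl G) λ { (inj₁ ()) ; (inj₂ ()) }
    adj⇔ left (inner t t≤k) = subst (λ v → Adj G a v ⇔ _) (sym (w-inner t≤k)) (mk⇔
      (λ a~pt → inj₁ (cong suc (sym (to (touches-start t t≤k) (adj-sym G a~pt)))))
      (λ { (inj₁ 1≡1+t) → adj-sym G (from (touches-start t t≤k) (sym (suc-injective 1≡1+t))) ; (inj₂ ()) }))
    adj⇔ left right = subst (λ v → Adj G a v ⇔ _) (sym w-right)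
      (fails⇔fails (proj₂ ends-separated) λ { (inj₁ 1≡2+k) → 0≢1+n (suc-injective 1≡2+k) ; (inj₂ ()) })
    adj⇔ (inner s s≤k) (inner t t≤k) = subst₂ (λ u v → Adj G u v ⇔ _) (sym (w-inner s≤k)) (sym (w-inner t≤k))
      (mk⇔ (Sum.map (cong suc) (cong suc) ∘ to (adjacent⇔ s t s≤k t≤k))
           (from (adjacent⇔ s t s≤k t≤k) ∘ Sum.map suc-injective suc-injective))
    adj⇔ (inner s s≤k) right = subst₂ (λ u v → Adj G u v ⇔ _) (sym (w-inner s≤k)) (sym w-right) (mk⇔
      (λ ps~b → inj₁ (cong (suc ∘ suc) (to (touches-end s s≤k) ps~b)))
      (λ { (inj₁ e) → from (touches-end s s≤k) (suc-injective (suc-injective e))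
         ; (inj₂ e) → ⊥-elim (1+n≰n (≤-trans (n≤1+n _) (≤-trans (≤-reflexive (suc-injective e)) s≤k))) }))
    adj⇔ right right = fails⇔fails (irrefl G) λ { (inj₁ e) → 1+n≢n e ; (inj₂ e) → 1+n≢n e }
    adj⇔ (inner s s≤k) left = consecutive-flip (adj⇔ left (inner s s≤k))
    adj⇔ right left = consecutive-flip (adj⇔ left right)
    adj⇔ right (inner t t≤k) = consecutive-flip (adj⇔ (inner t t≤k) right)

  data CloseIndex (m : ℕ) : ℕ → Set where
    on-path : ∀ t → t ≤ m → CloseIndex m t
    apex    : CloseIndex m (suc m)

  close-index : ∀ i → i < suc (suc m) → CloseIndex m i
  close-index {m} i i<2+m with i ≤? m
  ... | yes i≤m = on-path i i≤m
  ... | no  i≰m rewrite ≤-antisym (s≤s⁻¹ i<2+m) (≰⇒> i≰m) = apex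

  close-all : ∀ {ℓ} (Q : Fin n → Set ℓ) → (∀ t → t ≤ m → Q (p t)) → Q c →
              ∀ i → i < suc (suc m) → Q (splice m p (λ _ → c) i)
  close-all {m} {p} {c} Q qp qc i i<2+m with close-index i i<2+m
  ... | on-path t t≤m = subst Q (sym (splice-≤ m p _ t≤m)) (qp t t≤m)
  ... | apex          = subst Q (sym (splice-> m p _ (n<1+n m))) qc

  close-hole : IsChordlessSeq m p → (∀ t → t ≤ m → p t ≢ c) →
               (∀ t → t ≤ m → Adj G (p t) c ⇔ (t ≡ 0 ⊎ t ≡ m)) →
               IsHoleSeq (suc (suc m)) (splice m p (λ _ → c))
  close-hole {m} {p} {c} P avoids touches = record
    { injective = λ i j i< j< → inj (close-index i i<) (close-index j j<)
    ; adjacent⇔ = λ i j i< j< → adj⇔ (close-index i i<) (close-index j j<)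
    }
    where
    open IsChordlessSeq P
    w : ℕ → Fin n
    w = splice m p (λ _ → c)
    w-path : ∀ {t} → t ≤ m → w t ≡ p t
    w-path = splice-≤ m p (λ _ → c)
    w-apex : w (suc m) ≡ c
    w-apex = splice-> m p (λ _ → c) (n<1+n m)
    beyond : ∀ {t} → t ≤ m → suc t ≢ suc (suc m)
    beyond t≤m e = 1+n≰n (≤-trans (≤-reflexive (suc-injective (sym e))) t≤m)
    inj : ∀ {i j} → CloseIndex m i → CloseIndex m j → w i ≡ w j → i ≡ j
    inj (on-path s s≤m) (on-path t t≤m) e = injective s t s≤m t≤m (trans (sym (w-path s≤m)) (trans e (w-path t≤m)))
    inj (on-path s s≤m) apex e = ⊥-elim (avoids s s≤m (trans (sym (w-path s≤m)) (trans e w-apex)))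
    inj apex (on-path t t≤m) e = ⊥-elim (avoids t t≤m (trans (sym (w-path t≤m)) (trans (sym e) w-apex)))
    inj apex apex _ = refl
    adj⇔ : ∀ {i j} → CloseIndex m i → CloseIndex m j → Adj G (w i) (w j) ⇔ CycAdjℕ (suc (suc m)) i j
    adj⇔ (on-path s s≤m) (on-path t t≤m) = subst₂ (λ u v → Adj G u v ⇔ _) (sym (w-path s≤m)) (sym (w-path t≤m))
      (mk⇔ (Sum.map₂ inj₁ ∘ to (adjacent⇔ s t s≤m t≤m))
           (λ { (inj₁ e) → from (adjacent⇔ s t s≤m t≤m) (inj₁ e)
              ; (inj₂ (inj₁ e)) → from (adjacent⇔ s t s≤m t≤m) (inj₂ e)
              ; (inj₂ (inj₂ (inj₁ (_ , e)))) → ⊥-elim (beyond t≤m e)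
              ; (inj₂ (inj₂ (inj₂ (_ , e)))) → ⊥-elim (beyond s≤m e) }))
    adj⇔ (on-path s s≤m) apex = subst₂ (λ u v → Adj G u v ⇔ _) (sym (w-path s≤m)) (sym w-apex) (mk⇔
      (λ ps~c → Sum.[ (λ s≡0 → inj₂ (inj₂ (inj₁ (s≡0 , refl)))) , (λ s≡m → inj₁ (cong suc s≡m)) ]
                  (to (touches s s≤m) ps~c))
      (λ { (inj₁ e) → from (touches s s≤m) (inj₂ (suc-injective e))
         ; (inj₂ (inj₁ e)) → ⊥-elim (1+n≰n (≤-trans (≤-reflexive e) (m≤n⇒m≤1+n s≤m)))
         ; (inj₂ (inj₂ (inj₁ (s≡0 , _)))) → from (touches s s≤m) (inj₁ s≡0)
         ; (inj₂ (inj₂ (inj₂ (() , _)))) }))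
    adj⇔ apex (on-path t t≤m) = adj-flip CycAdjℕ-sym CycAdjℕ-sym (adj⇔ (on-path t t≤m) apex)
    adj⇔ apex apex = fails⇔fails (irrefl G)
      λ { (inj₁ e) → 1+n≢n e ; (inj₂ (inj₁ e)) → 1+n≢n e
        ; (inj₂ (inj₂ (inj₁ (() , _)))) ; (inj₂ (inj₂ (inj₂ (() , _)))) }

  interior-index : ∀ {i} → 0 < i → i < suc (suc k) → Σ ℕ λ t → t ≤ k × i ≡ suc t
  interior-index {i = suc t} _ t<1+k = t , s≤s⁻¹ (s≤s⁻¹ t<1+k) , refl

  theta : (k : Fin 3 → ℕ) (q : Fin 3 → ℕ → Fin n) → (∀ r → ChordlessLink a b (k r) (q r)) →
          (∀ r s → r ≢ s → ∀ t u → t ≤ k r → u ≤ k s → Separated (q r t) (q s u)) → Theta G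
  theta {a} {b} k q links separated = record
    { a         = a
    ; b         = b
    ; len       = len
    ; len≥2     = λ _ → s≤s (s≤s z≤n)
    ; path      = λ r i → path r (toℕ i)
    ; chordless = λ r → toChordlessPath (cap-chordless (links r))
    ; start     = λ _ → refl
    ; end       = λ r → trans (cong (path r) (Finₚ.toℕ-fromℕ (len r))) (cap-right {k = k r} {a = a} {p = q r})
    ; disj      = λ r s r≢s i j i° j° → proj₁ (inner-separated r s r≢s i° j°)
    ; noEdge    = λ r s r≢s i j i° j° → proj₂ (inner-separated r s r≢s i° j°)
    }
    where
    len : Fin 3 → ℕ
    len r = suc (suc (k r))
    path : Fin 3 → ℕ → Fin n
    path r = cap (k r) a (q r) b
    interior : ∀ r {i : Fin (suc (len r))} → Interior G (len r) i → Σ ℕ λ t → t ≤ k r × path r (toℕ i) ≡ q r t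
    interior r (0<i , i<len) with interior-index 0<i i<len
    ... | t , t≤k , i≡1+t = t , t≤k , trans (cong (path r) i≡1+t) (cap-inner {a = a} {b = b} t≤k)
    inner-separated : ∀ r s → r ≢ s → ∀ {i j} → Interior G (len r) i → Interior G (len s) j →
                      Separated (path r (toℕ i)) (path s (toℕ j))
    inner-separated r s r≢s i° j° with interior r i° | interior s j°
    ... | t , t≤ , e | u , u≤ , e′ = subst₂ Separated (sym e) (sym e′) (separated r s r≢s t u t≤ u≤)

  wheel : ∀ {m} → 4 ≤ m → IsHoleSeq m q → (∀ t → t < m → q t ≢ c) →
          ∀ {i j l} (i<m : i < m) (j<m : j < m) (l<m : l < m) → i ≢ j → i ≢ l → j ≢ l →
          Adj G c (q i) → Adj G c (q j) → Adj G c (q l) → Wheel G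
  wheel {q} {c} 4≤m H avoids i<m j<m l<m i≢j i≢l j≢l c~qi c~qj c~ql = record
    { rim    = toHole 4≤m H
    ; centre = c
    ; notIn  = λ i → avoids (toℕ i) (Finₚ.toℕ<n i)
    ; x      = fromℕ< i<m
    ; y      = fromℕ< j<m
    ; z      = fromℕ< l<m
    ; x≢y    = distinct i<m j<m i≢j
    ; x≢z    = distinct i<m l<m i≢l
    ; y≢z    = distinct j<m l<m j≢l
    ; adjx   = spoke i<m c~qi
    ; adjy   = spoke j<m c~qj
    ; adjz   = spoke l<m c~ql
    }
    where
    distinct : ∀ {s t m} (s<m : s < m) (t<m : t < m) → s ≢ t → fromℕ< s<m ≢ fromℕ< t<m
    distinct s<m t<m s≢t e = s≢t (trans (sym (Finₚ.toℕ-fromℕ< s<m)) (trans (cong toℕ e) (Finₚ.toℕ-fromℕ< t<m)))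
    spoke : ∀ {s m} (s<m : s < m) → Adj G c (q s) → Adj G c (q (toℕ (fromℕ< s<m)))
    spoke s<m = subst (Adj G c ∘ q) (sym (Finₚ.toℕ-fromℕ< s<m))

  common-neighbour-link : Separated a b → Adj G x a → Adj G x b → ChordlessLink a b 0 (λ _ → x)
  common-neighbour-link a⊥b x~a x~b = record
    { chordless      = single-seq
    ; ends-separated = a⊥b
    ; avoids-start   = λ _ _ → adj⇒≢ x~a
    ; avoids-end     = λ _ _ → adj⇒≢ x~b
    ; touches-start  = λ { zero _ → holds⇔holds x~a refl }
    ; touches-end    = λ { zero _ → holds⇔holds x~b refl }
    }

  separated-sym : Separated x y → Separated y x
  separated-sym (x≢y , x≁y) = (λ e → x≢y (sym e)) , (λ y~x → x≁y (adj-sym G y~x))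

pattern f0 = Fin.zero
pattern f1 = Fin.suc Fin.zero
pattern f2 = Fin.suc (Fin.suc Fin.zero)
pattern f3 = Fin.suc (Fin.suc (Fin.suc Fin.zero))

rotate : Fin 4 → Fin 4 → Fin 4
rotate f0 i  = i
rotate f1 f0 = f1
rotate f1 f1 = f2
rotate f1 f2 = f3
rotate f1 f3 = f0
rotate f2 f0 = f2
rotate f2 f1 = f3
rotate f2 f2 = f0
rotate f2 f3 = f1
rotate f3 f0 = f3
rotate f3 f1 = f0
rotate f3 f2 = f1
rotate f3 f3 = f2

rotate-f0 : ∀ c → rotate c f0 ≡ c
rotate-f0 f0 = refl
rotate-f0 f1 = refl
rotate-f0 f2 = refl
rotate-f0 f3 = refl

reflect : Fin 4 → Fin 4
reflect f0 = f0
reflect f1 = f3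
reflect f2 = f2
reflect f3 = f1

IsC₄-Automorphism : (Fin 4 → Fin 4) → Set
IsC₄-Automorphism σ = ∀ i j →
  (σ i ≡ σ j → i ≡ j) ×
  (CycAdjℕ 4 (toℕ (σ i)) (toℕ (σ j)) → CycAdjℕ 4 (toℕ i) (toℕ j)) ×
  (CycAdjℕ 4 (toℕ i) (toℕ j) → CycAdjℕ 4 (toℕ (σ i)) (toℕ (σ j)))

IsC₄-Automorphism? : ∀ σ → Dec (IsC₄-Automorphism σ)
IsC₄-Automorphism? σ = Finₚ.all? λ i → Finₚ.all? λ j →
  ((σ i Finₚ.≟ σ j) →-dec (i Finₚ.≟ j)) ×-dec
  (cyc (σ i) (σ j) →-dec cyc i j) ×-dec
  (cyc i j →-dec cyc (σ i) (σ j))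
  where cyc = λ (i j : Fin 4) → CycAdjℕ? 4 (toℕ i) (toℕ j)

rotate-automorphism : ∀ c → IsC₄-Automorphism (rotate c)
rotate-automorphism = toWitness {a? = Finₚ.all? (IsC₄-Automorphism? ∘ rotate)} _

reflect-automorphism : IsC₄-Automorphism reflect
reflect-automorphism = toWitness {a? = IsC₄-Automorphism? reflect} _

Outside : ∀ {n} → (Fin 4 → Fin n) → Fin n → Set
Outside h x = ∀ c → h c ≢ x

outside? : ∀ {n} (h : Fin 4 → Fin n) x → Dec (Outside h x)
outside? h x = Finₚ.all? λ c → ¬? (h c Finₚ.≟ x)

module Squares {n : ℕ} (G : Graph n) where
  open Sequences G

  private variable
    h : Fin 4 → Fin n
    x : Fin n

  record Square (h : Fin 4 → Fin n) : Set where
    field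
      injective : Injective _≡_ _≡_ h
      adjacent⇔ : ∀ i j → Adj G (h i) (h j) ⇔ CycAdj G 4 i j

  square-hole : Square h → Hole G
  square-hole {h} S = record
    { len = 4 ; len≥4 = ≤-refl ; cyc = h ; cyc-inj = injective ; cyc-ind = adjacent⇔ }
    where open Square S

  square-∘ : Square h → ∀ {σ} → IsC₄-Automorphism σ → Square (h ∘ σ)
  square-∘ S {σ} aut = record
    { injective = λ e → proj₁ (aut _ _) (injective e)
    ; adjacent⇔ = λ i j → mk⇔ (proj₁ (proj₂ (aut i j)) ∘ to (adjacent⇔ (σ i) (σ j)))
                              (from (adjacent⇔ (σ i) (σ j)) ∘ proj₂ (proj₂ (aut i j)))
    }
    where open Square S

  module SquareFacts {h : Fin 4 → Fin n} (S : Square h) where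
    open Square S

    adj₀₁ : Adj G (h f0) (h f1)
    adj₀₁ = from (adjacent⇔ f0 f1) (inj₁ refl)
    adj₁₂ : Adj G (h f1) (h f2)
    adj₁₂ = from (adjacent⇔ f1 f2) (inj₁ refl)
    adj₂₃ : Adj G (h f2) (h f3)
    adj₂₃ = from (adjacent⇔ f2 f3) (inj₁ refl)
    adj₃₀ : Adj G (h f3) (h f0)
    adj₃₀ = from (adjacent⇔ f3 f0) (inj₂ (inj₂ (inj₂ (refl , refl))))

    separated₀₂ : Separated (h f0) (h f2)
    separated₀₂ = (λ e → case (injective e) of λ ())
                , toWitnessFalse {a? = CycAdjℕ? 4 0 2} _ ∘ to (adjacent⇔ f0 f2)
    separated₁₃ : Separated (h f1) (h f3)
    separated₁₃ = (λ e → case (injective e) of λ ())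
                , toWitnessFalse {a? = CycAdjℕ? 4 1 3} _ ∘ to (adjacent⇔ f1 f3)

  square-wheel : Square h → Outside h x → Adj G x (h f0) → Adj G x (h f1) → Adj G x (h f2) → Wheel G
  square-wheel {h} {x} S outside x~h0 x~h1 x~h2 = record
    { rim = square-hole S ; centre = x ; notIn = outside ; x = f0 ; y = f1 ; z = f2
    ; x≢y = λ () ; x≢z = λ () ; y≢z = λ () ; adjx = x~h0 ; adjy = x~h1 ; adjz = x~h2 }

module Configurations {n : ℕ} (G : Graph n) {h : Fin 4 → Fin n} (S : Squares.Square G h) where
  open Sequences G
  open Squares G
  open SquareFacts S

  module _ {k : ℕ} {p : ℕ → Fin n} (L : ChordlessLink (h f0) (h f2) k p)
           (outside : ∀ t → t ≤ k → Outside h (p t)) where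
    open ChordlessLink L

    theta-of-link : (∀ t → t ≤ k → ¬ Adj G (p t) (h f1)) → (∀ t → t ≤ k → ¬ Adj G (p t) (h f3)) → Theta G
    theta-of-link p≁h1 p≁h3 = theta K Q links separated
      where
      K : Fin 3 → ℕ
      K f0 = 0
      K f1 = 0
      K f2 = k
      Q : Fin 3 → ℕ → Fin n
      Q f0 _ = h f1
      Q f1 _ = h f3
      Q f2   = p
      links : ∀ r → ChordlessLink (h f0) (h f2) (K r) (Q r)
      links f0 = common-neighbour-link separated₀₂ (adj-sym G adj₀₁) adj₁₂
      links f1 = common-neighbour-link separated₀₂ adj₃₀ (adj-sym G adj₂₃)
      links f2 = L
      apart : ∀ c → (∀ t → t ≤ k → ¬ Adj G (p t) (h c)) → ∀ t → t ≤ k → Separated (h c) (p t)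
      apart c p≁hc t t≤k = outside t t≤k c , p≁hc t t≤k ∘ adj-sym G
      separated : ∀ r s → r ≢ s → ∀ t u → t ≤ K r → u ≤ K s → Separated (Q r t) (Q s u)
      separated f0 f1 _ _ _ _ _     = separated₁₃
      separated f0 f2 _ _ u _ u≤k   = apart f1 p≁h1 u u≤k
      separated f1 f2 _ _ u _ u≤k   = apart f3 p≁h3 u u≤k
      separated f1 f0 _ _ _ _ _     = separated-sym separated₁₃
      separated f2 f0 _ t _ t≤k _   = separated-sym (apart f1 p≁h1 t t≤k)
      separated f2 f1 _ t _ t≤k _   = separated-sym (apart f3 p≁h3 t t≤k)
      separated f0 f0 r≢r _ _ _ _   = ⊥-elim (r≢r refl)
      separated f1 f1 r≢r _ _ _ _   = ⊥-elim (r≢r refl)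
      separated f2 f2 r≢r _ _ _ _   = ⊥-elim (r≢r refl)

    -- The rim is h f0, p 0, …, p k, h f2, h f3; the centre h f1 sees h f0, p t and h f2.
    wheel-of-link : (∀ t → t ≤ k → ¬ Adj G (p t) (h f3)) → ∀ t → t ≤ k → Adj G (p t) (h f1) → Wheel G
    wheel-of-link p≁h3 t t≤k pt~h1 =
      wheel (s≤s (s≤s (s≤s (s≤s z≤n)))) rim off-rim {0} {suc t} {suc (suc k)}
        (s≤s z≤n) (s≤s (s≤s (m≤n⇒m≤1+n (m≤n⇒m≤1+n t≤k)))) (s≤s (s≤s (s≤s (n≤1+n k))))
        (λ ()) (λ ()) (λ e → 1+n≰n (≤-trans (≤-reflexive (sym (suc-injective e))) t≤k))
        (subst (Adj G (h f1)) (sym (rim-path z≤n)) (adj-sym G adj₀₁))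
        (subst (Adj G (h f1)) (sym (trans (rim-path (s≤s (m≤n⇒m≤1+n t≤k))) (cap-inner {a = h f0} {b = h f2} t≤k)))
               (adj-sym G pt~h1))
        (subst (Adj G (h f1)) (sym (trans (rim-path ≤-refl) (cap-right {k = k} {a = h f0} {p = p}))) adj₁₂)
      where
      e : ℕ → Fin n
      e = cap k (h f0) p (h f2)
      e~h3 : ∀ i → i ≤ suc (suc k) → Adj G (e i) (h f3) ⇔ (i ≡ 0 ⊎ i ≡ suc (suc k))
      e~h3 i i≤2+k with cap-index i i≤2+k
      ... | left        = holds⇔holds (adj-sym G adj₃₀) (inj₁ refl)
      ... | inner s s≤k = subst (λ v → Adj G v (h f3) ⇔ _) (sym (cap-inner {a = h f0} {b = h f2} s≤k))
                            (fails⇔fails (p≁h3 s s≤k)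
                              λ { (inj₁ ())
                                ; (inj₂ e) → 1+n≰n (≤-trans (≤-reflexive (sym (suc-injective e))) s≤k) })
      ... | right       = subst (λ v → Adj G v (h f3) ⇔ _) (sym (cap-right {k = k} {a = h f0} {p = p}))
                            (holds⇔holds adj₂₃ (inj₂ refl))
      rim : IsHoleSeq (suc (suc (suc (suc k)))) (splice (suc (suc k)) e (λ _ → h f3))
      rim = close-hole (cap-chordless L)
              (cap-all (_≢ h f3) (adj⇒≢ (adj-sym G adj₃₀)) (λ s s≤k e → outside s s≤k f3 (sym e))
                 (adj⇒≢ adj₂₃))
              e~h3
      rim-path : ∀ {i} → i ≤ suc (suc k) → splice (suc (suc k)) e (λ _ → h f3) i ≡ e i
      rim-path = splice-≤ (suc (suc k)) e (λ _ → h f3)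
      off-rim : ∀ i → i < suc (suc (suc (suc k))) → splice (suc (suc k)) e (λ _ → h f3) i ≢ h f1
      off-rim = close-all (_≢ h f1)
        (cap-all (_≢ h f1) (adj⇒≢ adj₀₁) (λ s s≤k e → outside s s≤k f1 (sym e)) (adj⇒≢ (adj-sym G adj₁₂)))
        (λ e → proj₁ separated₁₃ (sym e))

    -- The three paths are p, the edge h f0 h f3 and the edge h f1 h f2.
    prism-of-link : 1 ≤ k → (∀ t → t ≤ k → Adj G (p t) (h f1) ⇔ t ≡ 0) →
                    (∀ t → t ≤ k → Adj G (p t) (h f3) ⇔ t ≡ k) → Prism G
    prism-of-link 1≤k p~h1 p~h3 = record
      { len       = K
      ; len≥1     = λ { f0 → 1≤k ; f1 → ≤-refl ; f2 → ≤-refl }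
      ; path      = λ r i → Q r (toℕ i)
      ; chordless = λ { f0 → toChordlessPath chordless
                      ; f1 → toChordlessPath (edge-seq (adj-sym G adj₃₀))
                      ; f2 → toChordlessPath (edge-seq adj₁₂) }
      ; disj      = disj
      ; edges     = edges
      }
      where
      K : Fin 3 → ℕ
      K f0 = k
      K f1 = 1
      K f2 = 1
      Q : Fin 3 → ℕ → Fin n
      Q f0 = p
      Q f1 = h f0 ◂ λ _ → h f3
      Q f2 = h f1 ◂ λ _ → h f2
      on-p : (i : Fin (suc k)) → toℕ i ≤ k
      on-p = Finₚ.toℕ≤pred[n]
      p≢Q₁ : ∀ (i : Fin (suc k)) (j : Fin 2) → p (toℕ i) ≢ Q f1 (toℕ j)
      p≢Q₁ i f0 = outside _ (on-p i) f0 ∘ sym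
      p≢Q₁ i f1 = outside _ (on-p i) f3 ∘ sym
      p≢Q₂ : ∀ (i : Fin (suc k)) (j : Fin 2) → p (toℕ i) ≢ Q f2 (toℕ j)
      p≢Q₂ i f0 = outside _ (on-p i) f1 ∘ sym
      p≢Q₂ i f1 = outside _ (on-p i) f2 ∘ sym
      Q₁≢Q₂ : ∀ (i j : Fin 2) → Q f1 (toℕ i) ≢ Q f2 (toℕ j)
      Q₁≢Q₂ f0 f0 = adj⇒≢ adj₀₁
      Q₁≢Q₂ f0 f1 = proj₁ separated₀₂
      Q₁≢Q₂ f1 f0 = proj₁ separated₁₃ ∘ sym
      Q₁≢Q₂ f1 f1 = adj⇒≢ adj₂₃ ∘ sym
      disj : ∀ r s → r ≢ s → ∀ (i : Fin (suc (K r))) (j : Fin (suc (K s))) → Q r (toℕ i) ≢ Q s (toℕ j)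
      disj f0 f1 _ i j = p≢Q₁ i j
      disj f0 f2 _ i j = p≢Q₂ i j
      disj f1 f2 _ i j = Q₁≢Q₂ i j
      disj f1 f0 _ i j = p≢Q₁ j i ∘ sym
      disj f2 f0 _ i j = p≢Q₂ j i ∘ sym
      disj f2 f1 _ i j = Q₁≢Q₂ j i ∘ sym
      disj f0 f0 r≢r _ _ = ⊥-elim (r≢r refl)
      disj f1 f1 r≢r _ _ = ⊥-elim (r≢r refl)
      disj f2 f2 r≢r _ _ = ⊥-elim (r≢r refl)
      Ends : ∀ r s → Fin (suc (K r)) → Fin (suc (K s)) → Set
      Ends r s i j = (toℕ i ≡ 0 × toℕ j ≡ 0) ⊎ (toℕ i ≡ K r × toℕ j ≡ K s)
      at-start : ∀ {i v} → Adj G (p (toℕ i)) v ⇔ toℕ i ≡ 0 → Adj G (p (toℕ i)) v ⇔ Ends f0 f1 i f0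
      at-start e = mk⇔ (λ a → inj₁ (to e a , refl)) λ { (inj₁ (i≡0 , _)) → from e i≡0 ; (inj₂ (_ , ())) }
      at-end : ∀ {i v} → Adj G (p (toℕ i)) v ⇔ toℕ i ≡ k → Adj G (p (toℕ i)) v ⇔ Ends f0 f1 i f1
      at-end e = mk⇔ (λ a → inj₂ (to e a , refl)) λ { (inj₂ (i≡k , _)) → from e i≡k ; (inj₁ (_ , ())) }
      swap-ends : {A B C D : Set} → (A × B) ⊎ (C × D) → (B × A) ⊎ (D × C)
      swap-ends = Sum.map swap swap
      p~Q₁ : ∀ i j → Adj G (p (toℕ i)) (Q f1 (toℕ j)) ⇔ Ends f0 f1 i j
      p~Q₁ i f0 = at-start (touches-start _ (on-p i))
      p~Q₁ i f1 = at-end (p~h3 _ (on-p i))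
      p~Q₂ : ∀ i j → Adj G (p (toℕ i)) (Q f2 (toℕ j)) ⇔ Ends f0 f2 i j
      p~Q₂ i f0 = at-start (p~h1 _ (on-p i))
      p~Q₂ i f1 = at-end (touches-end _ (on-p i))
      Q₁~Q₂ : ∀ i j → Adj G (Q f1 (toℕ i)) (Q f2 (toℕ j)) ⇔ Ends f1 f2 i j
      Q₁~Q₂ f0 f0 = holds⇔holds adj₀₁ (inj₁ (refl , refl))
      Q₁~Q₂ f0 f1 = fails⇔fails (proj₂ separated₀₂) λ { (inj₁ (_ , ())) ; (inj₂ (() , _)) }
      Q₁~Q₂ f1 f0 = fails⇔fails (proj₂ separated₁₃ ∘ adj-sym G) λ { (inj₁ (() , _)) ; (inj₂ (_ , ())) }
      Q₁~Q₂ f1 f1 = holds⇔holds (adj-sym G adj₂₃) (inj₂ (refl , refl))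
      edges : ∀ r s → r ≢ s → ∀ i j → Adj G (Q r (toℕ i)) (Q s (toℕ j)) ⇔ Ends r s i j
      edges f0 f1 _ i j = p~Q₁ i j
      edges f0 f2 _ i j = p~Q₂ i j
      edges f1 f2 _ i j = Q₁~Q₂ i j
      edges f1 f0 _ i j = adj-flip swap-ends swap-ends (p~Q₁ j i)
      edges f2 f0 _ i j = adj-flip swap-ends swap-ends (p~Q₂ j i)
      edges f2 f1 _ i j = adj-flip swap-ends swap-ends (Q₁~Q₂ j i)
      edges f0 f0 r≢r _ _ = ⊥-elim (r≢r refl)
      edges f1 f1 r≢r _ _ = ⊥-elim (r≢r refl)
      edges f2 f2 r≢r _ _ = ⊥-elim (r≢r refl)

module Crossings {n : ℕ} (G : Graph n) (Allowed : Fin n → Set)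
                 (¬theta : ¬ Theta G) (¬wheel : ¬ Wheel G) (¬prism : ¬ Prism G) where
  open Walks G Allowed
  open Sequences G
  open Squares G

  Avoids : (Fin 4 → Fin n) → Set
  Avoids h = ∀ x → Allowed x → Outside h x

  Crossing : (Fin 4 → Fin n) → ℕ → Set
  Crossing h k = Σ (Fin n) λ x → Σ (Fin n) λ y → Walk x y k × Adj G x (h f0) × Adj G y (h f2)

  NoCrossing : ℕ → Set
  NoCrossing k = ∀ {h} → Square h → Avoids h → ¬ Crossing h k

  module Shortest {k : ℕ} (shorter : ∀ {j} → j < k → NoCrossing j)
                  {h : Fin 4 → Fin n} (S : Square h) (avoids : Avoids h)
                  {x y : Fin n} (W : Walk x y k) (x~h0 : Adj G x (h f0)) (y~h2 : Adj G y (h f2)) where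
    open SquareFacts S
    open Configurations G S
    module Reflected = Configurations G (square-∘ S reflect-automorphism)

    P : ℕ → Fin n
    P = vertex W

    outside : ∀ t → t ≤ k → Outside h (P t)
    outside t t≤k = avoids (P t) (allowed W t t≤k)

    P0~h0 : Adj G (P 0) (h f0)
    P0~h0 = subst (λ v → Adj G v (h f0)) (sym (start W)) x~h0

    Pk~h2 : Adj G (P k) (h f2)
    Pk~h2 = subst (λ v → Adj G v (h f2)) (sym (end W)) y~h2

    no-proper-subcrossing : ∀ c {i j} → i ≤ j → j ≤ k → i ≢ 0 ⊎ j ≢ k →
                            Adj G (P i) (h (rotate c f0)) → Adj G (P j) (h (rotate c f2)) → ⊥
    no-proper-subcrossing c i≤j j≤k proper Pi~ Pj~ =
      shorter (proper-slice-shorter i≤j j≤k proper) (square-∘ S (rotate-automorphism c))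
        (λ v av d → avoids v av (rotate c d)) (_ , _ , slice W _ _ i≤j j≤k , Pi~ , Pj~)

    no-shorter-walk : ∀ {j} → j < k → Walk x y j → ⊥
    no-shorter-walk j<k V = shorter j<k S avoids (x , y , V , x~h0 , y~h2)

    repeat-free : ∀ {i j} → i < j → j ≤ k → P i ≢ P j
    repeat-free {i} i<j j≤k Pi≡Pj = no-shorter-walk (bypass-shorter {i} {m = 0} i<j j≤k)
      (bypass W (<⇒≤ i<j) j≤k (subst (λ v → Walk (P i) v 0) Pi≡Pj [ allowed W i (<⇒≤ (<-≤-trans i<j j≤k)) ]))

    chord-free : ∀ {i j} → suc i < j → j ≤ k → ¬ Adj G (P i) (P j)
    chord-free {i} {j} 1+i<j j≤k Pi~Pj = no-shorter-walk (bypass-shorter {i} {m = 1} 1+i<j j≤k)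
      (bypass W i≤j j≤k (edge (allowed W i (≤-trans i≤j j≤k)) (allowed W j j≤k) Pi~Pj))
      where i≤j = <⇒≤ (<-trans (n<1+n i) 1+i<j)

    chordless : IsChordlessSeq k P
    chordless = record { injective = inj ; adjacent⇔ = adj⇔ }
      where
      inj : ∀ i j → i ≤ k → j ≤ k → P i ≡ P j → i ≡ j
      inj i j i≤k j≤k Pi≡Pj with <-cmp i j
      ... | tri< i<j _ _ = ⊥-elim (repeat-free i<j j≤k Pi≡Pj)
      ... | tri≈ _ i≡j _ = i≡j
      ... | tri> _ _ j<i = ⊥-elim (repeat-free j<i i≤k (sym Pi≡Pj))
      successor : ∀ {i j} → i < j → j ≤ k → Adj G (P i) (P j) → suc i ≡ j
      successor {i} {j} i<j j≤k Pi~Pj with suc i ≟ j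
      ... | yes 1+i≡j = 1+i≡j
      ... | no  1+i≢j = ⊥-elim (chord-free (≤∧≢⇒< i<j 1+i≢j) j≤k Pi~Pj)
      adj⇔ : ∀ i j → i ≤ k → j ≤ k → Adj G (P i) (P j) ⇔ Consecutive i j
      adj⇔ i j i≤k j≤k = mk⇔ forward backward
        where
        forward : Adj G (P i) (P j) → Consecutive i j
        forward Pi~Pj with <-cmp i j
        ... | tri< i<j _ _ = inj₁ (successor i<j j≤k Pi~Pj)
        ... | tri≈ _ refl _ = ⊥-elim (irrefl G Pi~Pj)
        ... | tri> _ _ j<i = inj₂ (successor j<i i≤k (adj-sym G Pi~Pj))
        backward : Consecutive i j → Adj G (P i) (P j)
        backward (inj₁ refl) = adjacent W i j≤k
        backward (inj₂ refl) = adj-sym G (adjacent W j i≤k)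

    ends-only : ∀ c → Adj G (P 0) (h (rotate c f0)) → Adj G (P k) (h (rotate c f2)) →
                (∀ t → t ≤ k → Adj G (P t) (h (rotate c f0)) ⇔ t ≡ 0) ×
                (∀ t → t ≤ k → Adj G (P t) (h (rotate c f2)) ⇔ t ≡ k)
    ends-only c P0~ Pk~ = first , last
      where
      first : ∀ t → t ≤ k → Adj G (P t) (h (rotate c f0)) ⇔ t ≡ 0
      first zero    _       = holds⇔holds P0~ refl
      first (suc t) 1+t≤k = fails⇔fails (λ Pt~ → no-proper-subcrossing c 1+t≤k ≤-refl (inj₁ λ ()) Pt~ Pk~) λ ()
      last : ∀ t → t ≤ k → Adj G (P t) (h (rotate c f2)) ⇔ t ≡ k
      last t t≤k = mk⇔
        (λ Pt~ → decidable-stable (t ≟ k) λ t≢k → no-proper-subcrossing c z≤n t≤k (inj₂ t≢k) P0~ Pt~)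
                       (λ { refl → Pk~ })

    link : ChordlessLink (h f0) (h f2) k P
    link = record
      { chordless      = chordless
      ; ends-separated = separated₀₂
      ; avoids-start   = λ t t≤k → outside t t≤k f0 ∘ sym
      ; avoids-end     = λ t t≤k → outside t t≤k f2 ∘ sym
      ; touches-start  = proj₁ (ends-only f0 P0~h0 Pk~h2)
      ; touches-end    = proj₂ (ends-only f0 P0~h0 Pk~h2)
      }

    attached? : ∀ c → (Σ ℕ λ t → t ≤ k × Adj G (P t) (h c)) ⊎ (∀ t → t ≤ k → ¬ Adj G (P t) (h c))
    attached? c with anyUpTo? (λ t → adj? G (P t) (h c)) (suc k)
    ... | yes (t , s≤s t≤k , Pt~hc) = inj₁ (t , t≤k , Pt~hc)
    ... | no  none                  = inj₂ λ t t≤k Pt~hc → none (t , s≤s t≤k , Pt~hc)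

    rung₁₃ : Adj G (P 0) (h f1) → Adj G (P k) (h f3) → ⊥
    rung₁₃ P0~h1 Pk~h3 with k ≟ 0
    ... | yes refl = ¬wheel (square-wheel S (outside 0 z≤n) P0~h0 P0~h1 Pk~h2)
    ... | no  k≢0  = ¬prism (prism-of-link link outside (n≢0⇒n>0 k≢0) (proj₁ ends) (proj₂ ends))
      where ends = ends-only f1 P0~h1 Pk~h3

    rung₃₁ : Adj G (P 0) (h f3) → Adj G (P k) (h f1) → ⊥
    rung₃₁ P0~h3 Pk~h1 with k ≟ 0
    ... | yes refl = ¬wheel (square-wheel (square-∘ S reflect-automorphism) (outside 0 z≤n ∘ reflect)
                               P0~h0 P0~h3 Pk~h2)
    ... | no  k≢0  = ¬prism (Reflected.prism-of-link link (λ t t≤k → outside t t≤k ∘ reflect)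
                               (n≢0⇒n>0 k≢0) (proj₁ ends) (proj₂ ends))
      where ends = ends-only f3 P0~h3 Pk~h1

    rung : ∀ c {i j} → i ≤ j → j ≤ k → Adj G (P i) (h (rotate c f0)) → Adj G (P j) (h (rotate c f2)) →
           (Adj G (P 0) (h (rotate c f0)) → Adj G (P k) (h (rotate c f2)) → ⊥) → ⊥
    rung c {i} {j} i≤j j≤k Pi~ Pj~ whole with i ≟ 0 | j ≟ k
    ... | yes refl | yes refl = whole Pi~ Pj~
    ... | no  i≢0  | _        = no-proper-subcrossing c i≤j j≤k (inj₁ i≢0) Pi~ Pj~
    ... | yes _    | no  j≢k  = no-proper-subcrossing c i≤j j≤k (inj₂ j≢k) Pi~ Pj~

    impossible : ⊥
    impossible with attached? f1 | attached? f3
    ... | inj₂ none₁ | inj₂ none₃ = ¬theta (theta-of-link link outside none₁ none₃)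
    ... | inj₁ (t , t≤k , Pt~h1) | inj₂ none₃ = ¬wheel (wheel-of-link link outside none₃ t t≤k Pt~h1)
    ... | inj₂ none₁ | inj₁ (t , t≤k , Pt~h3) =
      ¬wheel (Reflected.wheel-of-link link (λ t t≤k → outside t t≤k ∘ reflect) none₁ t t≤k Pt~h3)
    ... | inj₁ (t₁ , t₁≤k , Pt₁~h1) | inj₁ (t₃ , t₃≤k , Pt₃~h3) with t₁ ≤? t₃
    ...   | yes t₁≤t₃ = rung f1 t₁≤t₃ t₃≤k Pt₁~h1 Pt₃~h3 rung₁₃
    ...   | no  t₁≰t₃ = rung f3 (<⇒≤ (≰⇒> t₁≰t₃)) t₁≤k Pt₃~h3 Pt₁~h1 rung₃₁

  no-crossing : ∀ k → NoCrossing k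
  no-crossing = <-rec NoCrossing λ k shorter S avoids (x , y , W , x~h0 , y~h2) →
    Shortest.impossible shorter S avoids W x~h0 y~h2

on-square? : ∀ {n} (h : Fin 4 → Fin n) y → Dec (Σ (Fin 4) λ c → h c ≡ y)
on-square? h y = Finₚ.any? λ c → h c Finₚ.≟ y

¬outside⇒on-square : ∀ {n} {h : Fin 4 → Fin n} {y} → ¬ Outside h y → Σ (Fin 4) λ c → h c ≡ y
¬outside⇒on-square {h = h} {y} ¬out with on-square? h y
... | yes on  = on
... | no  off = ⊥-elim (¬out λ c e → off (c , e))

module Component {n : ℕ} (G : Graph n) (h : Fin 4 → Fin n) (w : Fin n) where
  open Walks G (Outside h)

  private variable
    x y : Fin n
    l : ℕ

  Reach : ℕ → Fin n → Set
  Reach zero    x = x ≡ w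
  Reach (suc m) x = Reach m x ⊎ Σ (Fin n) λ y → Reach m y × Adj G y x × Outside h x

  reach? : ∀ m x → Dec (Reach m x)
  reach? zero    x = x Finₚ.≟ w
  reach? (suc m) x = reach? m x ⊎-dec Finₚ.any? λ y → reach? m y ×-dec adj? G y x ×-dec outside? h x

  reach-mono : ∀ {m m′} → m ≤ m′ → Reach m x → Reach m′ x
  reach-mono {m′ = zero}   z≤n      r = r
  reach-mono {m′ = suc m′} z≤n      r = inj₁ (reach-mono {m′ = m′} z≤n r)
  reach-mono               (s≤s le) (inj₁ r) = inj₁ (reach-mono le r)
  reach-mono               (s≤s le) (inj₂ (y , r , y~x , ox)) = inj₂ (y , reach-mono le r , y~x , ox)

  walk→reach : Walk w x l → Reach l x
  walk→reach {l = zero}  W = trans (sym (end W)) (start W)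
  walk→reach {l = suc l} W = inj₂ (_ , walk→reach (init W) , subst (Adj G _) (end W) (adjacent W l ≤-refl) ,
                                    allowed-end W)

  reach→walk : Outside h w → ∀ m → Reach m x → Σ ℕ λ l → l ≤ m × Walk w x l
  reach→walk ow zero    refl     = 0 , z≤n , [ ow ]
  reach→walk ow (suc m) (inj₁ r) with reach→walk ow m r
  ... | l , l≤m , W = l , m≤n⇒m≤1+n l≤m , W
  reach→walk ow (suc m) (inj₂ (y , r , y~x , ox)) with reach→walk ow m r
  ... | l , l≤m , W = l + 1 , subst (l + 1 ≤_) (+-comm m 1) (+-monoˡ-≤ 1 l≤m) ,
                      W ++ edge (allowed-end W) ox y~x

  InComponent : Fin n → Set
  InComponent = Reach n

  -- n steps suffice: by the pigeonhole principle a longer walk repeats a vertex and can be shortened.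
  walk→component : Walk w x l → InComponent x
  walk→component {l = l} = <-rec (λ l → ∀ {x} → Walk w x l → InComponent x) shorten l
    where
    shorten : ∀ l → (∀ {l′} → l′ < l → ∀ {x} → Walk w x l′ → InComponent x) →
              ∀ {x} → Walk w x l → InComponent x
    shorten l shorter W with l ≤? n
    ... | yes l≤n = reach-mono l≤n (walk→reach W)
    ... | no  l≰n with Finₚ.pigeonhole (n<1+n n) (λ i → vertex W (toℕ i))
    ...   | i , j , i<j , Wi≡Wj = shorter (bypass-shorter {m = 0} i<j j≤l)
              (bypass W (<⇒≤ i<j) j≤l (subst (λ v → Walk (vertex W (toℕ i)) v 0) Wi≡Wj
                [ allowed W (toℕ i) (<⇒≤ (<-≤-trans i<j j≤l)) ]))
      where j≤l = ≤-trans (Finₚ.toℕ≤pred[n] j) (<⇒≤ (≰⇒> l≰n))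

∈-pair : ∀ {n} {a b x : Fin n} → x ∈ ⁅ a ⁆ ∪ ⁅ b ⁆ → x ≡ a ⊎ x ≡ b
∈-pair {a = a} {b} x∈ = Sum.map (x∈⁅y⁆⇒x≡y a) (x∈⁅y⁆⇒x≡y b) (x∈p∪q⁻ ⁅ a ⁆ ⁅ b ⁆ x∈)

∉-pair : ∀ {n} {a b x : Fin n} → x ≢ a → x ≢ b → x ∉ ⁅ a ⁆ ∪ ⁅ b ⁆
∉-pair x≢a x≢b = Sum.[ x≢a , x≢b ] ∘ ∈-pair

∈-pairˡ : ∀ {n} (a b : Fin n) → a ∈ ⁅ a ⁆ ∪ ⁅ b ⁆
∈-pairˡ a b = x∈p∪q⁺ (inj₁ (x∈⁅x⁆ a))

∈-pairʳ : ∀ {n} (a b : Fin n) → b ∈ ⁅ a ⁆ ∪ ⁅ b ⁆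
∈-pairʳ a b = x∈p∪q⁺ (inj₂ (x∈⁅x⁆ b))

edge-clique : ∀ {n} (G : Graph n) {a b} → Adj G a b → IsClique G (⁅ a ⁆ ∪ ⁅ b ⁆)
edge-clique G {a} {b} a~b u v u∈ v∈ u≢v = adj (∈-pair u∈) (∈-pair v∈)
  where
  adj : u ≡ a ⊎ u ≡ b → v ≡ a ⊎ v ≡ b → Adj G u v
  adj (inj₁ refl) (inj₁ refl) = ⊥-elim (u≢v refl)
  adj (inj₁ refl) (inj₂ refl) = a~b
  adj (inj₂ refl) (inj₁ refl) = adj-sym G a~b
  adj (inj₂ refl) (inj₂ refl) = ⊥-elim (u≢v refl)

module CliqueCutset {n : ℕ} (G : Graph n) (¬theta : ¬ Theta G) (¬wheel : ¬ Wheel G) (¬prism : ¬ Prism G)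
                    {h : Fin 4 → Fin n} (S : Squares.Square G h)
                    {w : Fin n} (w-outside : Outside h w) (w~h0 : Adj G w (h f0)) where
  open Sequences G using (adj⇒≢)
  open Squares G
  open SquareFacts S
  open Walks G (Outside h)
  open Component G h w
  open Crossings G (Outside h) ¬theta ¬wheel ¬prism

  private variable
    x y : Fin n

  component-walk : InComponent x → Σ ℕ λ l → Walk w x l
  component-walk r with reach→walk w-outside n r
  ... | l , _ , W = l , W

  component-outside : InComponent x → Outside h x
  component-outside r = allowed-end (proj₂ (component-walk r))

  Attaches : Fin 4 → Set
  Attaches c = Σ (Fin n) λ x → InComponent x × Adj G x (h c)

  attaches? : ∀ c → Dec (Attaches c)
  attaches? c = Finₚ.any? λ x → reach? n x ×-dec adj? G x (h c)

  ¬attaches₂ : ¬ Attaches f2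
  ¬attaches₂ (x , r , x~h2) with component-walk r
  ... | l , W = no-crossing l S (λ _ o → o) (w , x , W , w~h0 , x~h2)

  ¬attaches₁₃ : Attaches f1 → Attaches f3 → ⊥
  ¬attaches₁₃ (x , r , x~h1) (y , r′ , y~h3) with component-walk r | component-walk r′
  ... | l , V | l′ , W = no-crossing (l + l′) (square-∘ S (rotate-automorphism f1)) (λ _ o c → o (rotate f1 c))
                           (x , y , reverse V ++ W , x~h1 , y~h3)

  separated-by : (C : Subset n) → IsClique G C → (∀ c → Attaches c → h c ∈ C) → w ∉ C → h f2 ∉ C →
                 HasCliqueCutset G
  separated-by C clique attachments w∉C h2∉C =
    C , clique , w , h f2 , w∉C , h2∉C , λ w⇝h2 → component-outside (stays w⇝h2 (reach-mono z≤n refl)) f2 refl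
    where
    head∉ : ∀ {u v} → ReachAvoiding G C u v → u ∉ C
    head∉ (here u∉C)     = u∉C
    head∉ (step u∉C _ _) = u∉C
    extend : InComponent x → Adj G x y → y ∉ C → InComponent y
    extend {x} {y} r x~y y∉C with outside? h y | component-walk r
    ... | yes out | _ , W = walk→component (W ++ edge (allowed-end W) out x~y)
    ... | no ¬out | _ with ¬outside⇒on-square ¬out
    ...   | c , refl = ⊥-elim (y∉C (attachments c (x , r , x~y)))
    stays : ∀ {u v} → ReachAvoiding G C u v → InComponent u → InComponent v
    stays (here _)          r = r
    stays (step _ u~v rest) r = stays rest (extend r u~v (head∉ rest))

  clique-cutset : HasCliqueCutset G
  clique-cutset with attaches? f1
  ... | yes at₁ = separated-by (⁅ h f0 ⁆ ∪ ⁅ h f1 ⁆) (edge-clique G adj₀₁) attachments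
                    (∉-pair (w-outside f0 ∘ sym) (w-outside f1 ∘ sym))
                    (∉-pair (proj₁ separated₀₂ ∘ sym) (adj⇒≢ adj₁₂ ∘ sym))
    where
    attachments : ∀ c → Attaches c → h c ∈ ⁅ h f0 ⁆ ∪ ⁅ h f1 ⁆
    attachments f0 _  = ∈-pairˡ _ _
    attachments f1 _  = ∈-pairʳ _ _
    attachments f2 at = ⊥-elim (¬attaches₂ at)
    attachments f3 at = ⊥-elim (¬attaches₁₃ at₁ at)
  ... | no ¬at₁ = separated-by (⁅ h f0 ⁆ ∪ ⁅ h f3 ⁆) (edge-clique G (adj-sym G adj₃₀)) attachments
                    (∉-pair (w-outside f0 ∘ sym) (w-outside f3 ∘ sym))
                    (∉-pair (proj₁ separated₀₂ ∘ sym) (adj⇒≢ adj₂₃))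
    where
    attachments : ∀ c → Attaches c → h c ∈ ⁅ h f0 ⁆ ∪ ⁅ h f3 ⁆
    attachments f0 _  = ∈-pairˡ _ _
    attachments f1 at = ⊥-elim (¬at₁ at)
    attachments f2 at = ⊥-elim (¬attaches₂ at)
    attachments f3 _  = ∈-pairʳ _ _

first-attachment : ∀ {n} (G : Graph n) (h : Fin 4 → Fin n) {u v} → ReachAvoiding G Data.Fin.Subset.⊥ u v →
                   Outside h u → ¬ Outside h v → Σ (Fin n) λ x → Outside h x × Σ (Fin 4) λ c → Adj G x (h c)
first-attachment G h (here _) out ¬out = ⊥-elim (¬out out)
first-attachment G h (step {u} {v} _ u~v rest) out ¬out with outside? h v
... | yes out′ = first-attachment G h rest out′ ¬out
... | no ¬out′ with ¬outside⇒on-square ¬out′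
...   | c , refl = u , out , c , u~v

square-cutset : ∀ {n} (G : Graph n) → Connected G → ¬ Theta G → ¬ Wheel G → ¬ Prism G →
                ∀ {h} → Squares.Square G h → ∀ {w} → Outside h w → HasCliqueCutset G
square-cutset G connected ¬theta ¬wheel ¬prism {h} S {w} w-outside
  with first-attachment G h (connected w (h f0)) w-outside (λ out → out f0 refl)
... | x , x-outside , c , x~hc = CliqueCutset.clique-cutset G ¬theta ¬wheel ¬prism
      (Squares.square-∘ G S (rotate-automorphism c)) (x-outside ∘ rotate c)
      (subst (Adj G x ∘ h) (sym (rotate-f0 c)) x~hc)

lemma5p2 : {n : ℕ} (G : Graph n) → Connected G →
           ¬ Theta G → ¬ Wheel G → ¬ Prism G →
           HoleOfLength G 4 → IsHole4 G ⊎ HasCliqueCutset G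
lemma5p2 G connected ¬theta ¬wheel ¬prism (H@record { cyc = h ; cyc-inj = injective ; cyc-ind = adjacent⇔ } , refl)
  with Finₚ.all? (on-square? h)
... | yes spanning = inj₁ ((H , refl) , spanning)
... | no ¬spanning with Finₚ.¬∀⟶∃¬ _ _ (on-square? h) ¬spanning
...   | w , w-off = inj₂ (square-cutset G connected ¬theta ¬wheel ¬prism
                            (record { injective = injective ; adjacent⇔ = adjacent⇔ }) (λ c e → w-off (c , e)))
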